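{- The following two sets of transformations are maximal simplifications from outside: $r_3$: $\neg \neg (\neg \neg A \wedge \neg \neg B) \Rightarrow \neg \neg A \wedge \neg \neg B$; $\neg \neg (\neg \neg A \vee \neg \neg B) \Rightarrow \neg \neg \neg A \to \neg \neg B$; $\neg \neg (\neg \neg A \to \neg \neg B) \Rightarrow \neg \neg A \to \neg \neg B$; $\neg\neg \forall x \neg \neg A \Rightarrow \forall x \neg \neg A$. $r_4$: $\neg (\neg \neg A \wedge \neg \neg B) \Rightarrow \neg \neg A \to \neg B$; $\neg (\neg \neg A \vee \neg \neg B) \Rightarrow \neg A \wedge \neg B$; $\neg (\neg \neg A \to \neg \neg B) \Rightarrow \neg \neg A \wedge \neg B$; $\neg \exists x \neg \neg A \Rightarrow \forall x \neg A$.
   Context: Work in first-order logic with primitives $\bot,\top,\wedge,\vee,\to,\forall,\exists$; $\neg C$ abbreviates $C\to\bot$; ${\sf IL}$ is intuitionistic logic. In transformations, $A,B$ are schematic formula variables and $x$ a variable. A simplification from outside is a set of transformations, at most one for each of the symbols $\wedge,\vee,\to,\forall,\exists$, each of the form $N(\neg \neg A \,\square\, \neg \neg B) \Rightarrow N_1 N A \, \square^{r} N_2 N B$ (for the connective $\square$) or $NQ x \neg \neg A \Rightarrow Q^{r} x N_1 N A$ (for the quantifier $Q$), where $\square, \square^{r} \in \{\wedge, \vee, \to\}$, $Q, Q^{r} \in \{\forall, \exists\}$, $N$ is either a single negation $\neg$ or a double negation $\neg\neg$ (the same choice for all transformations of the set), and $N_1$, $N_2$ are strings of negation symbols (possibly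 empty, not necessarily the same in different transformations), such that for each transformation (i) the two sides are equivalent in ${\sf IL}$ for all formulas $A,B$, and (ii) the number of negation symbols on the right side is strictly less than on the left side. A simplification (from outside) is maximal if (i) it is not properly included in any other simplification (from outside), i.e. adding transformations for further connectives or quantifiers prevents the set from being a simplification, and (ii) it is not possible to replace $\square^r$, $Q^r$, $N_1$, $N_2$ in any of its transformations so as to reduce the number of negations on the right side of that transformation while remaining a simplification. -}

module Defs where

open import Data.Nat using (ℕ; zero; suc; _+_; _<_)
open import Data.Fin using (Fin; zero; suc)
open import Data.Vec using (Vec; map)
open import Data.List using (List; []; _∷_) renaming (map to mapL)
open import Data.List.Membership.Propositional using (_∈_)
open import Data.Maybe using (Maybe; just; nothing)
open import Data.Product using (_×_)
open import Relation.Binary.PropositionalEquality using (_≡_; refl)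
open import Relation.Nullary using (¬_; Dec; yes; no)

-- First-order syntax (de Bruijn variables; countably many constants and
-- countably many predicate symbols of every arity)

data Term (n : ℕ) : Set where
  var : Fin n → Term n
  con : ℕ → Term n

infixr 6 _∧'_
infixr 5 _∨'_
infixr 4 _⇒_

data Formula (n : ℕ) : Set where
  rel  : (p k : ℕ) → Vec (Term n) k → Formula n
  ⊥' ⊤' : Formula n
  _∧'_ _∨'_ _⇒_ : Formula n → Formula n → Formula n
  ∀' ∃' : Formula (suc n) → Formula n

¬' : ∀ {n} → Formula n → Formula n
¬' C = C ⇒ ⊥'

negs : ∀ {n} → ℕ → Formula n → Formula n
negs zero    A = A
negs (suc k) A = ¬' (negs k A)

substT : ∀ {n m} → (Fin n → Term m) → Term n → Term m
substT σ (var i) = σ i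
substT σ (con c) = con c

wkT : ∀ {n} → Term n → Term (suc n)
wkT (var i) = var (suc i)
wkT (con c) = con c

liftS : ∀ {n m} → (Fin n → Term m) → Fin (suc n) → Term (suc m)
liftS σ zero    = var zero
liftS σ (suc i) = wkT (σ i)

substF : ∀ {n m} → (Fin n → Term m) → Formula n → Formula m
substF σ (rel p k ts) = rel p k (map (substT σ) ts)
substF σ ⊥'       = ⊥'
substF σ ⊤'       = ⊤'
substF σ (A ∧' B) = substF σ A ∧' substF σ B
substF σ (A ∨' B) = substF σ A ∨' substF σ B
substF σ (A ⇒ B)  = substF σ A ⇒ substF σ B
substF σ (∀' A)   = ∀' (substF (liftS σ) A)
substF σ (∃' A)   = ∃' (substF (liftS σ) A)

wk : ∀ {n} → Formula n → Formula (suc n)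
wk = substF (λ i → var (suc i))

inst1 : ∀ {n} → Term n → Fin (suc n) → Term n
inst1 t zero    = t
inst1 t (suc i) = var i

-- A[t/x] where x is the variable bound (de Bruijn index 0)
inst : ∀ {n} → Formula (suc n) → Term n → Formula n
inst A t = substF (inst1 t) A

infix 2 _⊢_

data _⊢_ : {n : ℕ} → List (Formula n) → Formula n → Set where
  hyp  : ∀ {n} {Γ : List (Formula n)} {A} → A ∈ Γ → Γ ⊢ A
  ⊤I   : ∀ {n} {Γ : List (Formula n)} → Γ ⊢ ⊤'
  ⊥E   : ∀ {n} {Γ : List (Formula n)} {A} → Γ ⊢ ⊥' → Γ ⊢ A
  ∧I   : ∀ {n} {Γ : List (Formula n)} {A B} → Γ ⊢ A → Γ ⊢ B → Γ ⊢ A ∧' B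
  ∧E₁  : ∀ {n} {Γ : List (Formula n)} {A B} → Γ ⊢ A ∧' B → Γ ⊢ A
  ∧E₂  : ∀ {n} {Γ : List (Formula n)} {A B} → Γ ⊢ A ∧' B → Γ ⊢ B
  ∨I₁  : ∀ {n} {Γ : List (Formula n)} {A B} → Γ ⊢ A → Γ ⊢ A ∨' B
  ∨I₂  : ∀ {n} {Γ : List (Formula n)} {A B} → Γ ⊢ B → Γ ⊢ A ∨' B
  ∨E   : ∀ {n} {Γ : List (Formula n)} {A B C} →
         Γ ⊢ A ∨' B → (A ∷ Γ) ⊢ C → (B ∷ Γ) ⊢ C → Γ ⊢ C
  ⇒I   : ∀ {n} {Γ : List (Formula n)} {A B} → (A ∷ Γ) ⊢ B → Γ ⊢ A ⇒ B
  ⇒E   : ∀ {n} {Γ : List (Formula n)} {A B} → Γ ⊢ A ⇒ B → Γ ⊢ A → Γ ⊢ B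
  ∀I   : ∀ {n} {Γ : List (Formula n)} {A : Formula (suc n)} →
         mapL wk Γ ⊢ A → Γ ⊢ ∀' A
  ∀E   : ∀ {n} {Γ : List (Formula n)} {A : Formula (suc n)} →
         Γ ⊢ ∀' A → (t : Term n) → Γ ⊢ inst A t
  ∃I   : ∀ {n} {Γ : List (Formula n)} {A : Formula (suc n)} →
         (t : Term n) → Γ ⊢ inst A t → Γ ⊢ ∃' A
  ∃E   : ∀ {n} {Γ : List (Formula n)} {A : Formula (suc n)} {C} →
         Γ ⊢ ∃' A → (A ∷ mapL wk Γ) ⊢ wk C → Γ ⊢ C

_≣_ : ∀ {n} → Formula n → Formula n → Set
A ≣ B = ([] ⊢ A ⇒ B) × ([] ⊢ B ⇒ A)

data Conn : Set where
  and or imp : Conn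

data Quant : Set where
  all ex : Quant

applyC : ∀ {n} → Conn → Formula n → Formula n → Formula n
applyC and A B = A ∧' B
applyC or  A B = A ∨' B
applyC imp A B = A ⇒ B

applyQ : ∀ {n} → Quant → Formula (suc n) → Formula n
applyQ all A = ∀' A
applyQ ex  A = ∃' A

data Sym : Set where
  conn  : Conn → Sym
  quant : Quant → Sym

data NChoice : Set where
  single double : NChoice

nN : NChoice → ℕ
nN single = 1
nN double = 2

-- The free data of the right side of a transformation:
--   for a connective: (□ʳ , |N₁| , |N₂|);   for a quantifier: (Qʳ , |N₁|)
Rhs : Sym → Set
Rhs (conn _)  = Conn × ℕ × ℕ
Rhs (quant _) = Quant × ℕ

open import Data.Product using (_,_)

-- left side  N(¬¬A □ ¬¬B)  resp.  N Q x ¬¬A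
-- right side N₁ N A □ʳ N₂ N B  resp.  Qʳ x N₁ N A
-- Validity (i): both sides IL-equivalent for all formulas A, B
Valid : NChoice → (s : Sym) → Rhs s → Set
Valid N (conn c) (c' , k₁ , k₂) =
  ∀ {n} (A B : Formula n) →
    negs (nN N) (applyC c (negs 2 A) (negs 2 B))
      ≣ applyC c' (negs (k₁ + nN N) A) (negs (k₂ + nN N) B)
Valid N (quant q) (q' , k₁) =
  ∀ {n} (A : Formula (suc n)) →
    negs (nN N) (applyQ q (negs 2 A)) ≣ applyQ q' (negs (k₁ + nN N) A)

lhsNegs : NChoice → Sym → ℕ
lhsNegs N (conn _)  = nN N + 4
lhsNegs N (quant _) = nN N + 2

rhsNegs : NChoice → (s : Sym) → Rhs s → ℕ
rhsNegs N (conn _)  (_ , k₁ , k₂) = (k₁ + nN N) + (k₂ + nN N)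
rhsNegs N (quant _) (_ , k₁)      = k₁ + nN N

Fewer : NChoice → (s : Sym) → Rhs s → Set
Fewer N s r = rhsNegs N s r < lhsNegs N s

-- Sets of transformations: a common N and at most one transformation
-- for each symbol.

record TSet : Set where
  constructor tset
  field
    N  : NChoice
    tr : (s : Sym) → Maybe (Rhs s)
open TSet public

IsSimplification : TSet → Set
IsSimplification S =
  ∀ s r → tr S s ≡ just r → Valid (N S) s r × Fewer (N S) s r

InT : NChoice → (s : Sym) → Rhs s → TSet → Set
InT M s r S = (M ≡ N S) × (tr S s ≡ just r)

_⊆T_ : TSet → TSet → Set
S ⊆T S' = ∀ M s r → InT M s r S → InT M s r S'

_≟C_ : (a b : Conn) → Dec (a ≡ b)
and ≟C and = yes refl
or  ≟C or  = yes refl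
imp ≟C imp = yes refl
and ≟C or  = no λ ()
and ≟C imp = no λ ()
or  ≟C and = no λ ()
or  ≟C imp = no λ ()
imp ≟C and = no λ ()
imp ≟C or  = no λ ()

_≟Q_ : (a b : Quant) → Dec (a ≡ b)
all ≟Q all = yes refl
ex  ≟Q ex  = yes refl
all ≟Q ex  = no λ ()
ex  ≟Q all = no λ ()

replace : TSet → (s : Sym) → Rhs s → TSet
replace S s r' = tset (N S) (go s r')
  where
  go : (s : Sym) → Rhs s → (t : Sym) → Maybe (Rhs t)
  go (conn c)  r (conn d)  with c ≟C d
  ... | yes refl = just r
  ... | no _     = tr S (conn d)
  go (conn c)  r (quant q) = tr S (quant q)
  go (quant q) r (conn c)  = tr S (conn c)
  go (quant q) r (quant p) with q ≟Q p
  ... | yes refl = just r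
  ... | no _     = tr S (quant p)

-- Maximal simplification (from outside):
--  (i)  not properly included in any other simplification;
--  (ii) no transformation's □ʳ/Qʳ, N₁, N₂ can be replaced so as to reduce
--       the number of negations on its right side while remaining a
--       simplification.
IsMaximal : TSet → Set
IsMaximal S =
  IsSimplification S
  × (∀ S' → IsSimplification S' → S ⊆T S' → S' ⊆T S)
  × (∀ s r r' → tr S s ≡ just r → rhsNegs (N S) s r' < rhsNegs (N S) s r →
       ¬ IsSimplification (replace S s r'))

r₃ : TSet
r₃ = tset double t
  where
  t : (s : Sym) → Maybe (Rhs s)
  t (conn and)  = just (and , 0 , 0)   -- ¬¬A ∧ ¬¬B
  t (conn or)   = just (imp , 1 , 0)   -- ¬¬¬A → ¬¬B
  t (conn imp)  = just (imp , 0 , 0)   -- ¬¬A → ¬¬B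
  t (quant all) = just (all , 0)       -- ∀x ¬¬A
  t (quant ex)  = nothing

r₄ : TSet
r₄ = tset single t
  where
  t : (s : Sym) → Maybe (Rhs s)
  t (conn and)  = just (imp , 1 , 0)   -- ¬¬A → ¬B
  t (conn or)   = just (and , 0 , 0)   -- ¬A ∧ ¬B
  t (conn imp)  = just (and , 1 , 0)   -- ¬¬A ∧ ¬B
  t (quant all) = nothing
  t (quant ex)  = just (all , 0)       -- ∀x ¬A

module Submission where

-- By maximality-criterion, a nonempty simplification S is maximal as soon as
-- it is unextendable (a symbol without a transformation in S admits no valid
-- transformation with fewer negations) and optimal (no valid right side for a
-- symbol of S has fewer negations than the one in S).  Counting negations
-- shows that every competitor has zero or one extra negation on its letters,
-- and that most transformations of r₃, r₄ are optimal for trivial reasons.  The remaining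
-- competitors are refuted semantically: IL is sound for constant-domain
-- Kripke models, so a world forcing exactly one side of a would-be
-- equivalence refutes it.  Classical counterexamples built from ⊤ and ⊥
-- suffice in most cases; the intuitionistic ones use a root below two leaves.

open import Defs
open import Data.Bool using (Bool; true; false)
open import Data.Empty using (⊥; ⊥-elim)
open import Data.Fin using (Fin; zero; suc)
open import Data.List using (List; []; _∷_) renaming (map to mapL)
open import Data.List.Relation.Binary.Subset.Propositional using (_⊆_)
open import Data.List.Relation.Binary.Subset.Propositional.Properties using (∷⁺ʳ; map⁺)
open import Data.List.Relation.Unary.All as All using (All; []; _∷_)
import Data.List.Relation.Unary.All.Properties as AllProps
open import Data.List.Relation.Unary.Any using (here; there)
open import Data.Maybe using (just; nothing)
open import Data.Nat using (ℕ; zero; suc; _+_; _<_; _≤_; s≤s; _<?_)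
open import Data.Nat.Properties using (≤⇒≯; <⇒≱; m≤n+m; +-mono-≤; +-monoʳ-≤; +-suc; +-comm; +-cancelʳ-<; ≤-pred)
open import Data.Product using (_×_; _,_; proj₁; proj₂; Σ)
open import Data.Sum using (_⊎_; inj₁; inj₂)
open import Data.Unit using (⊤; tt)
open import Data.Vec using (Vec; []; _∷_) renaming (map to mapV)
open import Data.Vec.Properties using (map-∘; map-cong; map-id)
open import Function.Bundles using (_⇔_; mk⇔; Equivalence)
open import Relation.Binary.PropositionalEquality using (_≡_; refl; sym; trans; cong; cong₂; subst)
open import Relation.Nullary using (¬_)
open import Relation.Nullary.Decidable using (True; toWitness)

open Equivalence using (to; from)

replace-self : ∀ S s r → tr (replace S s r) s ≡ just r
replace-self S (conn and)  r = refl
replace-self S (conn or)   r = refl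
replace-self S (conn imp)  r = refl
replace-self S (quant all) r = refl
replace-self S (quant ex)  r = refl

Unextendable : TSet → Set
Unextendable S = ∀ s r → tr S s ≡ nothing → Valid (N S) s r → ¬ Fewer (N S) s r

Optimal : TSet → Set
Optimal S = ∀ s r r' → tr S s ≡ just r → rhsNegs (N S) s r' < rhsNegs (N S) s r →
  ¬ Valid (N S) s r'

-- Nonemptiness forces any simplification containing S to share its N; such a
-- simplification then agrees with S on S's symbols and, by unextendability,
-- has no others.
maximality-criterion : ∀ S s₀ r₀ → tr S s₀ ≡ just r₀ →
  IsSimplification S → Unextendable S → Optimal S → IsMaximal S
maximality-criterion S s₀ r₀ e₀ simp unext opt = simp , no-extension , no-improvement
  where
  no-extension : ∀ S' → IsSimplification S' → S ⊆T S' → S' ⊆T S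
  no-extension (tset N' _) simp' S⊆S' M s r (M≡N' , e') with S⊆S' (N S) s₀ r₀ (refl , e₀)
  ... | refl , _ = M≡N' , agree
    where
    agree : tr S s ≡ just r
    agree with tr S s in eq
    ... | just r₁ = trans (sym (proj₂ (S⊆S' (N S) s r₁ (refl , eq)))) e'
    ... | nothing = ⊥-elim (unext s r eq (proj₁ (simp' s r e')) (proj₂ (simp' s r e')))

  no-improvement : ∀ s r r' → tr S s ≡ just r → rhsNegs (N S) s r' < rhsNegs (N S) s r →
    ¬ IsSimplification (replace S s r')
  no-improvement s r r' e fewer simp' = opt s r r' e fewer (proj₁ (simp' s r' (replace-self S s r')))

-- Each of the schematic letters on a right side carries at least N.
baseNegs : NChoice → Sym → ℕ
baseNegs N (conn _)  = nN N + nN N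
baseNegs N (quant _) = nN N

rhs-lower-bound : ∀ N s r → baseNegs N s ≤ rhsNegs N s r
rhs-lower-bound N (conn _)  (_ , k₁ , k₂) = +-mono-≤ (m≤n+m (nN N) k₁) (m≤n+m (nN N) k₂)
rhs-lower-bound N (quant _) (_ , k)       = m≤n+m (nN N) k

-- So a right side without extra negations cannot be improved upon ...
below-base : ∀ N s r → ¬ (rhsNegs N s r < baseNegs N s)
below-base N s r = ≤⇒≯ (rhs-lower-bound N s r)

-- ... and improving on one extra negation (N₁ = ¬, N₂ empty) leaves none.
below-one-extra : ∀ j k₁ k₂ → (k₁ + j) + (k₂ + j) < (1 + j) + (0 + j) → k₁ ≡ 0 × k₂ ≡ 0
below-one-extra j zero    zero    _       = refl , refl
below-one-extra j (suc m) k₂      (s≤s h) =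
  ⊥-elim (<⇒≱ h (+-mono-≤ (m≤n+m j m) (m≤n+m j k₂)))
below-one-extra j zero    (suc m) h       =
  ⊥-elim (<⇒≱ h (subst (_≤ j + suc (m + j)) (+-suc j j) (+-monoʳ-≤ j (s≤s (m≤n+m j m)))))

-- A quantifier transformation with fewer negations than N Q x ¬¬A has at
-- most one extra negation.
below-quantifier : ∀ j k → k + j < j + 2 → k ≤ 1
below-quantifier j k h = ≤-pred (+-cancelʳ-< j k 2 (subst (k + j <_) (+-comm j 2) h))

<-by-evaluation : ∀ {m n} {proof : True (m <? n)} → m < n
<-by-evaluation {proof = p} = toWitness p

substT-∘ : ∀ {n m k} {σ : Fin m → Term k} {τ : Fin n → Term m} {ρ : Fin n → Term k} →
  (∀ i → substT σ (τ i) ≡ ρ i) → ∀ t → substT σ (substT τ t) ≡ substT ρ t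
substT-∘ h (var i) = h i
substT-∘ h (con c) = refl

liftS-∘ : ∀ {n m k} {σ : Fin m → Term k} {τ : Fin n → Term m} {ρ : Fin n → Term k} →
  (∀ i → substT σ (τ i) ≡ ρ i) → ∀ i → substT (liftS σ) (liftS τ i) ≡ liftS ρ i
liftS-∘ h zero = refl
liftS-∘ {σ = σ} {τ} h (suc i) = trans (commute (τ i)) (cong wkT (h i))
  where
  commute : ∀ t → substT (liftS σ) (wkT t) ≡ wkT (substT σ t)
  commute (var i) = refl
  commute (con c) = refl

substF-∘ : ∀ {n m k} {σ : Fin m → Term k} {τ : Fin n → Term m} {ρ : Fin n → Term k} →
  (∀ i → substT σ (τ i) ≡ ρ i) → ∀ A → substF σ (substF τ A) ≡ substF ρ A
substF-∘ {σ = σ} {τ} h (rel p k ts) =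
  cong (rel p k) (trans (sym (map-∘ (substT σ) (substT τ) ts)) (map-cong (substT-∘ h) ts))
substF-∘ h ⊥'       = refl
substF-∘ h ⊤'       = refl
substF-∘ h (A ∧' B) = cong₂ _∧'_ (substF-∘ h A) (substF-∘ h B)
substF-∘ h (A ∨' B) = cong₂ _∨'_ (substF-∘ h A) (substF-∘ h B)
substF-∘ h (A ⇒ B)  = cong₂ _⇒_ (substF-∘ h A) (substF-∘ h B)
substF-∘ h (∀' A)   = cong ∀' (substF-∘ (liftS-∘ h) A)
substF-∘ h (∃' A)   = cong ∃' (substF-∘ (liftS-∘ h) A)

liftS-id : ∀ {n} {σ : Fin n → Term n} → (∀ i → σ i ≡ var i) → ∀ i → liftS σ i ≡ var i
liftS-id h zero    = refl
liftS-id h (suc i) = cong wkT (h i)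

substF-id : ∀ {n} {σ : Fin n → Term n} → (∀ i → σ i ≡ var i) → ∀ A → substF σ A ≡ A
substF-id h (rel p k ts) = cong (rel p k) (trans (map-cong onTerm ts) (map-id ts))
  where
  onTerm : ∀ t → substT _ t ≡ t
  onTerm (var i) = h i
  onTerm (con c) = refl
substF-id h ⊥'       = refl
substF-id h ⊤'       = refl
substF-id h (A ∧' B) = cong₂ _∧'_ (substF-id h A) (substF-id h B)
substF-id h (A ∨' B) = cong₂ _∨'_ (substF-id h A) (substF-id h B)
substF-id h (A ⇒ B)  = cong₂ _⇒_ (substF-id h A) (substF-id h B)
substF-id h (∀' A)   = cong ∀' (substF-id (liftS-id h) A)
substF-id h (∃' A)   = cong ∃' (substF-id (liftS-id h) A)

-- Weakening the body of a quantifier and instantiating it at the fresh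
-- variable gives the body back; this is what ∀E/∃I produce under ∀I/∃E.
inst-wk-fresh : ∀ {n} (A : Formula (suc n)) →
  inst (substF (liftS (λ i → var (suc i))) A) (var zero) ≡ A
inst-wk-fresh A = trans (substF-∘ {ρ = var} fresh A) (substF-id (λ _ → refl) A)
  where
  fresh : ∀ i → substT (inst1 (var zero)) (liftS (λ i → var (suc i)) i) ≡ var i
  fresh zero    = refl
  fresh (suc i) = refl

weaken : ∀ {n} {Γ Δ : List (Formula n)} {A} → Γ ⊆ Δ → Γ ⊢ A → Δ ⊢ A
weaken f (hyp x)    = hyp (f x)
weaken f ⊤I         = ⊤I
weaken f (⊥E p)     = ⊥E (weaken f p)
weaken f (∧I p q)   = ∧I (weaken f p) (weaken f q)
weaken f (∧E₁ p)    = ∧E₁ (weaken f p)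
weaken f (∧E₂ p)    = ∧E₂ (weaken f p)
weaken f (∨I₁ p)    = ∨I₁ (weaken f p)
weaken f (∨I₂ p)    = ∨I₂ (weaken f p)
weaken f (∨E p q s) = ∨E (weaken f p) (weaken (∷⁺ʳ _ f) q) (weaken (∷⁺ʳ _ f) s)
weaken f (⇒I p)     = ⇒I (weaken (∷⁺ʳ _ f) p)
weaken f (⇒E p q)   = ⇒E (weaken f p) (weaken f q)
weaken f (∀I p)     = ∀I (weaken (map⁺ wk f) p)
weaken f (∀E p t)   = ∀E (weaken f p) t
weaken f (∃I t p)   = ∃I t (weaken f p)
weaken f (∃E p q)   = ∃E (weaken f p) (weaken (∷⁺ʳ _ (map⁺ wk f)) q)

v₀ : ∀ {n} {Γ : List (Formula n)} {A} → (A ∷ Γ) ⊢ A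
v₀ = hyp (here refl)

v₁ : ∀ {n} {Γ : List (Formula n)} {A B} → (B ∷ A ∷ Γ) ⊢ A
v₁ = hyp (there (here refl))

v₂ : ∀ {n} {Γ : List (Formula n)} {A B C} → (C ∷ B ∷ A ∷ Γ) ⊢ A
v₂ = hyp (there (there (here refl)))

¬¬-intro : ∀ {n} {Γ : List (Formula n)} {X} → Γ ⊢ X → Γ ⊢ negs 2 X
¬¬-intro p = ⇒I (⇒E v₀ (weaken there p))

retype : ∀ {n} {Γ : List (Formula n)} {A B} → A ≡ B → Γ ⊢ A → Γ ⊢ B
retype refl p = p

¬¬-bind : ∀ {n} {Γ : List (Formula n)} {X Z} → Γ ⊢ negs 2 X → (X ∷ Γ) ⊢ ¬' Z → Γ ⊢ ¬' Z
¬¬-bind p q = ⇒I (⇒E (weaken there p) (⇒I (⇒E (weaken (∷⁺ʳ _ there) q) v₁)))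

r₃-∧-valid : Valid double (conn and) (and , 0 , 0)
r₃-∧-valid A B = ⇒I (∧I (¬¬-bind v₀ (∧E₁ v₀)) (¬¬-bind v₀ (∧E₂ v₀))) , ⇒I (¬¬-intro v₀)

r₃-∨-valid : Valid double (conn or) (imp , 1 , 0)
r₃-∨-valid A B = ⇒I (⇒I (¬¬-bind v₁ (∨E v₀ (⊥E (⇒E v₂ v₀)) v₀)))
               , ⇒I (⇒I (⇒E v₀ (∨I₂ (⇒E v₁ (⇒I (⇒E v₁ (∨I₁ v₀)))))))

r₃-⇒-valid : Valid double (conn imp) (imp , 0 , 0)
r₃-⇒-valid A B = ⇒I (⇒I (¬¬-bind v₁ (⇒E v₀ v₁))) , ⇒I (¬¬-intro v₀)

r₃-∀-valid : Valid double (quant all) (all , 0)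
r₃-∀-valid A =
    ⇒I (∀I (¬¬-bind v₀ (retype (cong (negs 2) (inst-wk-fresh A)) (∀E v₀ (var zero)))))
  , ⇒I (¬¬-intro v₀)

r₄-∧-valid : Valid single (conn and) (imp , 1 , 0)
r₄-∧-valid A B = ⇒I (⇒I (⇒I (⇒E v₂ (∧I v₁ (¬¬-intro v₀)))))
               , ⇒I (⇒I (⇒E (∧E₂ v₀) (⇒E v₁ (∧E₁ v₀))))

r₄-∨-valid : Valid single (conn or) (and , 0 , 0)
r₄-∨-valid A B = ⇒I (∧I (⇒I (⇒E v₁ (∨I₁ (¬¬-intro v₀)))) (⇒I (⇒E v₁ (∨I₂ (¬¬-intro v₀)))))
               , ⇒I (⇒I (∨E v₀ (⇒E v₀ (∧E₁ v₂)) (⇒E v₀ (∧E₂ v₂))))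

r₄-⇒-valid : Valid single (conn imp) (and , 1 , 0)
r₄-⇒-valid A B = ⇒I (∧I (⇒I (⇒E v₁ (⇒I (⊥E (⇒E v₀ v₁))))) (⇒I (⇒E v₁ (⇒I (¬¬-intro v₁)))))
               , ⇒I (⇒I (⇒E (⇒E v₀ (∧E₁ v₁)) (∧E₂ v₁)))

r₄-∃-valid : Valid single (quant ex) (all , 0)
r₄-∃-valid A =
    ⇒I (∀I (⇒I (⇒E v₁ (∃I (var zero)
      (retype (sym (cong (negs 2) (inst-wk-fresh A))) (¬¬-intro v₀))))))
  , ⇒I (⇒I (∃E v₀ (⇒E v₀ (retype (cong ¬' (inst-wk-fresh A)) (∀E v₂ (var zero))))))

record KripkeModel : Set₁ where
  field
    World     : Set
    _≼_       : World → World → Set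
    ≼-refl    : ∀ {w} → w ≼ w
    ≼-trans   : ∀ {u v w} → u ≼ v → v ≼ w → u ≼ w
    Dom       : Set
    ⟦con⟧     : ℕ → Dom
    Atom      : World → (p k : ℕ) → Vec Dom k → Set
    Atom-mono : ∀ {w w'} p k ds → w ≼ w' → Atom w p k ds → Atom w' p k ds

module Forcing (M : KripkeModel) where
  open KripkeModel M

  Env : ℕ → Set
  Env n = Fin n → Dom

  infixr 5 _∷ᵉ_
  _∷ᵉ_ : ∀ {n} → Dom → Env n → Env (suc n)
  (d ∷ᵉ ρ) zero    = d
  (d ∷ᵉ ρ) (suc i) = ρ i

  ⟦_⟧ : ∀ {n} → Term n → Env n → Dom
  ⟦ var i ⟧ ρ = ρ i
  ⟦ con c ⟧ ρ = ⟦con⟧ c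

  infix 3 _⊩⟨_⟩_
  _⊩⟨_⟩_ : ∀ {n} → World → Env n → Formula n → Set
  w ⊩⟨ ρ ⟩ rel p k ts = Atom w p k (mapV (λ t → ⟦ t ⟧ ρ) ts)
  w ⊩⟨ ρ ⟩ ⊥'         = ⊥
  w ⊩⟨ ρ ⟩ ⊤'         = ⊤
  w ⊩⟨ ρ ⟩ A ∧' B     = (w ⊩⟨ ρ ⟩ A) × (w ⊩⟨ ρ ⟩ B)
  w ⊩⟨ ρ ⟩ A ∨' B     = (w ⊩⟨ ρ ⟩ A) ⊎ (w ⊩⟨ ρ ⟩ B)
  w ⊩⟨ ρ ⟩ A ⇒ B      = ∀ w' → w ≼ w' → w' ⊩⟨ ρ ⟩ A → w' ⊩⟨ ρ ⟩ B
  w ⊩⟨ ρ ⟩ ∀' A       = ∀ d → w ⊩⟨ d ∷ᵉ ρ ⟩ A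
  w ⊩⟨ ρ ⟩ ∃' A       = Σ Dom (λ d → w ⊩⟨ d ∷ᵉ ρ ⟩ A)

  monotone : ∀ {n} (A : Formula n) {ρ w w'} → w ≼ w' → w ⊩⟨ ρ ⟩ A → w' ⊩⟨ ρ ⟩ A
  monotone (rel p k ts) le x        = Atom-mono p k _ le x
  monotone ⊤'           le x        = tt
  monotone (A ∧' B)     le (x , y)  = monotone A le x , monotone B le y
  monotone (A ∨' B)     le (inj₁ x) = inj₁ (monotone A le x)
  monotone (A ∨' B)     le (inj₂ y) = inj₂ (monotone B le y)
  monotone (A ⇒ B)      le f        = λ w'' le' → f w'' (≼-trans le le')
  monotone (∀' A)       le f        = λ d → monotone A le (f d)
  monotone (∃' A)       le (d , x)  = d , monotone A le x

  wkT-eval : ∀ {n} {ρ : Env n} {d} t → ⟦ wkT t ⟧ (d ∷ᵉ ρ) ≡ ⟦ t ⟧ ρ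
  wkT-eval (var i) = refl
  wkT-eval (con c) = refl

  liftS-eval : ∀ {n m} {σ : Fin n → Term m} {ρ ρ'} → (∀ i → ⟦ σ i ⟧ ρ ≡ ρ' i) →
    ∀ d i → ⟦ liftS σ i ⟧ (d ∷ᵉ ρ) ≡ (d ∷ᵉ ρ') i
  liftS-eval h d zero    = refl
  liftS-eval {σ = σ} h d (suc i) = trans (wkT-eval (σ i)) (h i)

  substitution : ∀ {n m} (A : Formula n) {σ : Fin n → Term m} {ρ : Env m} {ρ' : Env n} →
    (∀ i → ⟦ σ i ⟧ ρ ≡ ρ' i) → ∀ {w} → (w ⊩⟨ ρ ⟩ substF σ A) ⇔ (w ⊩⟨ ρ' ⟩ A)
  substitution (rel p k ts) {σ} {ρ} {ρ'} h {w} =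
    mk⇔ (subst (Atom w p k) evaluate) (subst (Atom w p k) (sym evaluate))
    where
    onTerm : ∀ t → ⟦ substT σ t ⟧ ρ ≡ ⟦ t ⟧ ρ'
    onTerm (var i) = h i
    onTerm (con c) = refl
    evaluate : mapV (λ t → ⟦ t ⟧ ρ) (mapV (substT σ) ts) ≡ mapV (λ t → ⟦ t ⟧ ρ') ts
    evaluate = trans (sym (map-∘ _ (substT σ) ts)) (map-cong onTerm ts)
  substitution ⊥' h = mk⇔ (λ x → x) (λ x → x)
  substitution ⊤' h = mk⇔ (λ x → x) (λ x → x)
  substitution (A ∧' B) h =
    mk⇔ (λ (x , y) → to (substitution A h) x , to (substitution B h) y)
        (λ (x , y) → from (substitution A h) x , from (substitution B h) y)
  substitution (A ∨' B) h =
    mk⇔ (λ { (inj₁ x) → inj₁ (to (substitution A h) x) ; (inj₂ y) → inj₂ (to (substitution B h) y) })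
        (λ { (inj₁ x) → inj₁ (from (substitution A h) x) ; (inj₂ y) → inj₂ (from (substitution B h) y) })
  substitution (A ⇒ B) h =
    mk⇔ (λ f w' le x → to (substitution B h) (f w' le (from (substitution A h) x)))
        (λ f w' le x → from (substitution B h) (f w' le (to (substitution A h) x)))
  substitution (∀' A) h =
    mk⇔ (λ f d → to (substitution A (liftS-eval h d)) (f d))
        (λ f d → from (substitution A (liftS-eval h d)) (f d))
  substitution (∃' A) h =
    mk⇔ (λ (d , x) → d , to (substitution A (liftS-eval h d)) x)
        (λ (d , x) → d , from (substitution A (liftS-eval h d)) x)

  _⊩⟨_⟩*_ : ∀ {n} → World → Env n → List (Formula n) → Set
  w ⊩⟨ ρ ⟩* Γ = All (w ⊩⟨ ρ ⟩_) Γ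

  weaken-env : ∀ {n} {w ρ d} {Γ : List (Formula n)} →
    w ⊩⟨ ρ ⟩* Γ → w ⊩⟨ d ∷ᵉ ρ ⟩* mapL wk Γ
  weaken-env γ = AllProps.map⁺ (All.map (λ {B} → from (substitution B (λ _ → refl))) γ)

  instantiate : ∀ {n} {ρ : Env n} (t : Term n) → ∀ i → ⟦ inst1 t i ⟧ ρ ≡ (⟦ t ⟧ ρ ∷ᵉ ρ) i
  instantiate t zero    = refl
  instantiate t (suc i) = refl

  soundness : ∀ {n} {Γ : List (Formula n)} {A} → Γ ⊢ A →
    ∀ {w ρ} → w ⊩⟨ ρ ⟩* Γ → w ⊩⟨ ρ ⟩ A
  soundness (hyp x)    γ = All.lookup γ x
  soundness ⊤I         γ = tt
  soundness (⊥E p)     γ = ⊥-elim (soundness p γ)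
  soundness (∧I p q)   γ = soundness p γ , soundness q γ
  soundness (∧E₁ p)    γ = proj₁ (soundness p γ)
  soundness (∧E₂ p)    γ = proj₂ (soundness p γ)
  soundness (∨I₁ p)    γ = inj₁ (soundness p γ)
  soundness (∨I₂ p)    γ = inj₂ (soundness p γ)
  soundness (∨E p q s) γ with soundness p γ
  ... | inj₁ x = soundness q (x ∷ γ)
  ... | inj₂ y = soundness s (y ∷ γ)
  soundness (⇒I p)     γ = λ w' le x → soundness p (x ∷ All.map (λ {B} → monotone B le) γ)
  soundness (⇒E p q)   γ = soundness p γ _ ≼-refl (soundness q γ)
  soundness (∀I p)     γ = λ d → soundness p (weaken-env γ)
  soundness (∀E {A = A} p t) {ρ = ρ} γ =
    from (substitution A (instantiate t)) (soundness p γ (⟦ t ⟧ ρ))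
  soundness (∃I {A = A} t p) {ρ = ρ} γ =
    ⟦ t ⟧ ρ , to (substitution A (instantiate t)) (soundness p γ)
  soundness (∃E {C = C} p q) γ with soundness p γ
  ... | d , x = to (substitution C (λ _ → refl)) (soundness q (x ∷ weaken-env γ))

  ρ₀ : Env 0
  ρ₀ ()

  infix 3 _⊩_
  _⊩_ : World → Formula 0 → Set
  w ⊩ A = w ⊩⟨ ρ₀ ⟩ A

  separates : ∀ {X Y : Formula 0} w → w ⊩ X → ¬ (w ⊩ Y) → ¬ X ≣ Y
  separates w x ¬y (X⇒Y , _) = ¬y (soundness X⇒Y [] w ≼-refl x)

  separates′ : ∀ {X Y : Formula 0} w → ¬ (w ⊩ X) → w ⊩ Y → ¬ X ≣ Y
  separates′ w ¬x y (_ , Y⇒X) = ¬x (soundness Y⇒X [] w ≼-refl y)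

  ¬¬-intro-forced : ∀ {w} (X : Formula 0) → w ⊩ X → w ⊩ negs 2 X
  ¬¬-intro-forced X x w' le k = k w' ≼-refl (monotone X le x)

  ¬-refutes : ∀ {w} (X : Formula 0) → w ⊩ X → ¬ (w ⊩ ¬' X)
  ¬-refutes X x k = k _ ≼-refl x

  ⇒-refl-forced : ∀ {w} (X : Formula 0) → w ⊩ X ⇒ X
  ⇒-refl-forced X _ _ x = x

  ¬⊥-forced : ∀ {w} → w ⊩ ¬' ⊥'
  ¬⊥-forced = ⇒-refl-forced ⊥'

  ¬¬⊤-forced : ∀ {w} → w ⊩ negs 2 ⊤'
  ¬¬⊤-forced = ¬¬-intro-forced ⊤' tt

  ¬⊤-unforced : ∀ {w} → ¬ (w ⊩ ¬' ⊤')
  ¬⊤-unforced = ¬-refutes ⊤' tt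

  ¬¬⊥-unforced : ∀ {w} → ¬ (w ⊩ negs 2 ⊥')
  ¬¬⊥-unforced = ¬-refutes (¬' ⊥') ¬⊥-forced

data Node : Set where
  root left right : Node

data _≤ᵥ_ : Node → Node → Set where
  ≤ᵥ-refl : ∀ {w} → w ≤ᵥ w
  root≤ᵥ  : ∀ {w} → root ≤ᵥ w

≤ᵥ-trans : ∀ {u v w} → u ≤ᵥ v → v ≤ᵥ w → u ≤ᵥ w
≤ᵥ-trans ≤ᵥ-refl le = le
≤ᵥ-trans root≤ᵥ  _  = root≤ᵥ

Marked : Node → Bool → Set
Marked left  true  = ⊤
Marked right false = ⊤
Marked _     _     = ⊥

V : KripkeModel
V = record
  { World     = Node
  ; _≼_       = _≤ᵥ_
  ; ≼-refl    = ≤ᵥ-refl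
  ; ≼-trans   = ≤ᵥ-trans
  ; Dom       = Bool
  ; ⟦con⟧     = λ { zero → true ; (suc _) → false }
  ; Atom      = atom
  ; Atom-mono = atom-mono
  }
  where
  atom : Node → (p k : ℕ) → Vec Bool k → Set
  atom w p zero    []      = ⊥
  atom w p (suc k) (d ∷ _) = Marked w d

  atom-mono : ∀ {w w'} p k ds → w ≤ᵥ w' → atom w p k ds → atom w' p k ds
  atom-mono p k ds ≤ᵥ-refl x = x
  atom-mono p (suc k) (d ∷ _) root≤ᵥ ()

open Forcing V

-- the atoms used in the counterexamples: a holds only at the left leaf,
-- b only at the right one, and P x holds at the leaf marking x
a b : Formula 0
a = rel 0 1 (con 0 ∷ [])
b = rel 0 1 (con 1 ∷ [])

P : Formula 1
P = rel 0 1 (var zero ∷ [])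

-- Every node lies below one of the leaves, so a formula is refuted at a node
-- as soon as it fails at both leaves.
below-leaf : ∀ w → w ≤ᵥ left ⊎ w ≤ᵥ right
below-leaf root  = inj₁ root≤ᵥ
below-leaf left  = inj₁ ≤ᵥ-refl
below-leaf right = inj₂ ≤ᵥ-refl

¬-from-leaves : ∀ (X : Formula 0) {w} → ¬ (left ⊩ X) → ¬ (right ⊩ X) → w ⊩ ¬' X
¬-from-leaves X ¬l ¬r w' _ x with below-leaf w'
... | inj₁ le = ¬l (monotone X le x)
... | inj₂ le = ¬r (monotone X le x)

¬¬-from-leaves : ∀ (X : Formula 0) {w} → left ⊩ X → right ⊩ X → w ⊩ negs 2 X
¬¬-from-leaves X l r = ¬-from-leaves (¬' X) (¬-refutes X l) (¬-refutes X r)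

-- The root forces ¬¬∃x¬¬P (each leaf has a witness) and ¬∀x¬¬P (each leaf
-- has a counter-witness), although it decides P for no individual.
root-¬¬∃¬¬P : root ⊩ negs 2 (∃' (negs 2 P))
root-¬¬∃¬¬P = ¬¬-from-leaves (∃' (negs 2 P))
  (true  , λ { _ ≤ᵥ-refl ¬P → ¬P left ≤ᵥ-refl tt })
  (false , λ { _ ≤ᵥ-refl ¬P → ¬P right ≤ᵥ-refl tt })

root-¬∀¬¬P : root ⊩ ¬' (∀' (negs 2 P))
root-¬∀¬¬P = ¬-from-leaves (∀' (negs 2 P))
  (λ g → g false left ≤ᵥ-refl (λ { _ ≤ᵥ-refl () }))
  (λ g → g true right ≤ᵥ-refl (λ { _ ≤ᵥ-refl () }))

-- ¬¬(¬¬A ∨ ¬¬B) is equivalent to none of ¬¬A □ ¬¬B.  For □ = ∧, → take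
-- A = ⊤, B = ⊥; for □ = ∨ take the atoms a, b: each leaf forces one
-- disjunct, yet the root forces neither.
¬¬∨-irreducible : ∀ c → ¬ Valid double (conn or) (c , 0 , 0)
¬¬∨-irreducible and v =
  separates root (¬¬-intro-forced (negs 2 ⊤' ∨' negs 2 ⊥') (inj₁ ¬¬⊤-forced))
    (λ (_ , ¬¬⊥) → ¬¬⊥-unforced ¬¬⊥) (v ⊤' ⊥')
¬¬∨-irreducible imp v =
  separates root (¬¬-intro-forced (negs 2 ⊤' ∨' negs 2 ⊥') (inj₁ ¬¬⊤-forced))
    (λ f → ¬¬⊥-unforced (f root ≤ᵥ-refl ¬¬⊤-forced)) (v ⊤' ⊥')
¬¬∨-irreducible or v = separates root lhs rhs (v a b)
  where
  lhs : root ⊩ negs 2 (negs 2 a ∨' negs 2 b)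
  lhs = ¬¬-from-leaves (negs 2 a ∨' negs 2 b)
          (inj₁ (¬¬-intro-forced a tt)) (inj₂ (¬¬-intro-forced b tt))
  rhs : ¬ (root ⊩ negs 2 a ∨' negs 2 b)
  rhs (inj₁ ¬¬a) = ¬¬a right root≤ᵥ (λ { _ ≤ᵥ-refl () })
  rhs (inj₂ ¬¬b) = ¬¬b left root≤ᵥ (λ { _ ≤ᵥ-refl () })

-- ¬¬∃x¬¬A is equivalent to none of ∀x¬¬A, ∃x¬¬A (take A = P, see
-- root-¬¬∃¬¬P) and ∀x¬¬¬A, ∃x¬¬¬A (take A = ⊤).
¬¬∃-irreducible : ∀ q k → k ≤ 1 → ¬ Valid double (quant ex) (q , k)
¬¬∃-irreducible all zero _ v =
  separates root root-¬¬∃¬¬P (λ g → g false left root≤ᵥ (λ { _ ≤ᵥ-refl () })) (v P)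
¬¬∃-irreducible ex zero _ v = separates root root-¬¬∃¬¬P rhs (v P)
  where
  rhs : ¬ (root ⊩ ∃' (negs 2 P))
  rhs (true  , ¬¬P) = ¬¬P right root≤ᵥ (λ { _ ≤ᵥ-refl () })
  rhs (false , ¬¬P) = ¬¬P left root≤ᵥ (λ { _ ≤ᵥ-refl () })
¬¬∃-irreducible all (suc zero) _ v =
  separates root (¬¬-intro-forced (∃' (negs 2 ⊤')) (true , ¬¬⊤-forced))
    (λ g → ¬-refutes (negs 2 ⊤') ¬¬⊤-forced (g true)) (v ⊤')
¬¬∃-irreducible ex (suc zero) _ v =
  separates root (¬¬-intro-forced (∃' (negs 2 ⊤')) (true , ¬¬⊤-forced))
    (λ (_ , ¬¬¬⊤) → ¬-refutes (negs 2 ⊤') ¬¬⊤-forced ¬¬¬⊤) (v ⊤')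
¬¬∃-irreducible q (suc (suc k)) (s≤s ())

-- ¬(¬¬A ∧ ¬¬B) is equivalent to none of ¬A □ ¬B.  For □ = ∧, → take
-- A = ⊥, B = ⊤; for □ = ∨ take a, b: no node forces both ¬¬a and ¬¬b, yet
-- the root forces neither ¬a nor ¬b.
¬∧-irreducible : ∀ c → ¬ Valid single (conn and) (c , 0 , 0)
¬∧-irreducible and v =
  separates root (λ _ _ (¬¬⊥ , _) → ¬¬⊥-unforced ¬¬⊥) (λ (_ , ¬⊤) → ¬⊤-unforced ¬⊤) (v ⊥' ⊤')
¬∧-irreducible imp v =
  separates root (λ _ _ (¬¬⊥ , _) → ¬¬⊥-unforced ¬¬⊥)
    (λ f → ¬⊤-unforced (f root ≤ᵥ-refl ¬⊥-forced)) (v ⊥' ⊤')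
¬∧-irreducible or v = separates root lhs rhs (v a b)
  where
  lhs : root ⊩ ¬' (negs 2 a ∧' negs 2 b)
  lhs = ¬-from-leaves (negs 2 a ∧' negs 2 b)
          (λ (_ , ¬¬b) → ¬¬b left ≤ᵥ-refl (λ { _ ≤ᵥ-refl () }))
          (λ (¬¬a , _) → ¬¬a right ≤ᵥ-refl (λ { _ ≤ᵥ-refl () }))
  rhs : ¬ (root ⊩ ¬' a ∨' ¬' b)
  rhs (inj₁ ¬a) = ¬a left root≤ᵥ tt
  rhs (inj₂ ¬b) = ¬b right root≤ᵥ tt

-- ¬(¬¬A → ¬¬B) is equivalent to none of ¬A □ ¬B; classical counterexamples
-- suffice (A = ⊤, B = ⊥ for ∧ and A = B = ⊥ otherwise).
¬⇒-irreducible : ∀ c → ¬ Valid single (conn imp) (c , 0 , 0)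
¬⇒-irreducible and v =
  separates root (λ w _ f → ¬¬⊥-unforced (f w ≤ᵥ-refl ¬¬⊤-forced))
    (λ (¬⊤ , _) → ¬⊤-unforced ¬⊤) (v ⊤' ⊥')
¬⇒-irreducible or v =
  separates′ root (¬-refutes (negs 2 ⊥' ⇒ negs 2 ⊥') (⇒-refl-forced (negs 2 ⊥')))
    (inj₁ ¬⊥-forced) (v ⊥' ⊥')
¬⇒-irreducible imp v =
  separates′ root (¬-refutes (negs 2 ⊥' ⇒ negs 2 ⊥') (⇒-refl-forced (negs 2 ⊥')))
    (⇒-refl-forced (¬' ⊥')) (v ⊥' ⊥')

-- ¬∀x¬¬A is equivalent to none of ∀x¬A, ∃x¬A (take A = P, see root-¬∀¬¬P)
-- and ∀x¬¬A (take A = ⊥), ∃x¬¬A (take A = ⊤).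
¬∀-irreducible : ∀ q k → k ≤ 1 → ¬ Valid single (quant all) (q , k)
¬∀-irreducible all zero _ v = separates root root-¬∀¬¬P (λ g → g true left root≤ᵥ tt) (v P)
¬∀-irreducible ex zero _ v = separates root root-¬∀¬¬P rhs (v P)
  where
  rhs : ¬ (root ⊩ ∃' (¬' P))
  rhs (true  , ¬P) = ¬P left root≤ᵥ tt
  rhs (false , ¬P) = ¬P right root≤ᵥ tt
¬∀-irreducible all (suc zero) _ v =
  separates root (λ _ _ g → ¬¬⊥-unforced (g true)) (λ g → ¬¬⊥-unforced (g true)) (v ⊥')
¬∀-irreducible ex (suc zero) _ v =
  separates′ root (¬-refutes (∀' (negs 2 ⊤')) (λ _ → ¬¬⊤-forced)) (true , ¬¬⊤-forced) (v ⊤')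
¬∀-irreducible q (suc (suc k)) (s≤s ())

r₃-simplification : IsSimplification r₃
r₃-simplification (conn and)  _ refl = r₃-∧-valid , <-by-evaluation
r₃-simplification (conn or)   _ refl = r₃-∨-valid , <-by-evaluation
r₃-simplification (conn imp)  _ refl = r₃-⇒-valid , <-by-evaluation
r₃-simplification (quant all) _ refl = r₃-∀-valid , <-by-evaluation

r₃-unextendable : Unextendable r₃
r₃-unextendable (quant ex) (q , k) refl v fewer = ¬¬∃-irreducible q k (below-quantifier 2 k fewer) v
r₃-unextendable (conn and) _ ()
r₃-unextendable (conn or)  _ ()
r₃-unextendable (conn imp) _ ()

-- The right sides for ∧, → and ∀ carry no extra negation; for ∨ the only
-- cheaper candidates ¬¬A □ ¬¬B are invalid.
r₃-optimal : Optimal r₃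
r₃-optimal (conn and)  _ r' refl fewer _ = below-base double (conn and) r' fewer
r₃-optimal (conn imp)  _ r' refl fewer _ = below-base double (conn imp) r' fewer
r₃-optimal (quant all) _ r' refl fewer _ = below-base double (quant all) r' fewer
r₃-optimal (conn or)   _ (c , k₁ , k₂) refl fewer with below-one-extra 2 k₁ k₂ fewer
... | refl , refl = ¬¬∨-irreducible c

r₄-simplification : IsSimplification r₄
r₄-simplification (conn and) _ refl = r₄-∧-valid , <-by-evaluation
r₄-simplification (conn or)  _ refl = r₄-∨-valid , <-by-evaluation
r₄-simplification (conn imp) _ refl = r₄-⇒-valid , <-by-evaluation
r₄-simplification (quant ex) _ refl = r₄-∃-valid , <-by-evaluation

r₄-unextendable : Unextendable r₄
r₄-unextendable (quant all) (q , k) refl v fewer = ¬∀-irreducible q k (below-quantifier 1 k fewer) v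
r₄-unextendable (conn and) _ ()
r₄-unextendable (conn or)  _ ()
r₄-unextendable (conn imp) _ ()

-- The right sides for ∨ and ∃ carry no extra negation; for ∧ and → the only
-- cheaper candidates ¬A □ ¬B are invalid.
r₄-optimal : Optimal r₄
r₄-optimal (conn or)  _ r' refl fewer _ = below-base single (conn or) r' fewer
r₄-optimal (quant ex) _ r' refl fewer _ = below-base single (quant ex) r' fewer
r₄-optimal (conn and) _ (c , k₁ , k₂) refl fewer with below-one-extra 1 k₁ k₂ fewer
... | refl , refl = ¬∧-irreducible c
r₄-optimal (conn imp) _ (c , k₁ , k₂) refl fewer with below-one-extra 1 k₁ k₂ fewer
... | refl , refl = ¬⇒-irreducible c

-- Both sets contain the transformation for ∧, hence are nonempty.
proposition7 : IsMaximal r₃ × IsMaximal r₄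
proposition7 =
    maximality-criterion r₃ (conn and) _ refl r₃-simplification r₃-unextendable r₃-optimal
  , maximality-criterion r₄ (conn and) _ refl r₄-simplification r₄-unextendable r₄-optimal
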